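{- For $n\in\mathbb N$ and $(g,v,a,b,c,d,e)\in\mathbb N^7$, define $$\begin{aligned} S(n,g,v,a,b,c,d,e)={}&(c-12^{3g+2})^2+(d-ag)^2+(e-bg)^2+(2^n-2^{g+v})^2\\ &+(2^c-2^{3d+2a})^2+(2^{c+1}-2^{6e+5b})^2 . \end{aligned}$$ Then, for every $n\in\mathbb N$, every solution $(g,v,a,b,c,d,e)\in\mathbb N^7$ of $S(n,g,v,a,b,c,d,e)=0$ belongs to the cube $[0,t(n)-1]^7$, where $t(n)=12^{3n+3}$.
   Context: $\mathbb N=\{0,1,2,\dots\}$. Subtraction in $S$ is ordinary integer subtraction. $[0,T]^7$ denotes $\{0,1,\dots,T\}^7$. -}

module Defs where

open import Data.Nat as ℕ using (ℕ; _^_)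
open import Data.Integer using (ℤ; +_; _-_; _+_; _*_)

sq : ℤ → ℤ
sq x = x * x

S : ℕ → ℕ → ℕ → ℕ → ℕ → ℕ → ℕ → ℕ → ℤ
S n g v a b c d e =
  sq (+ c - + (12 ^ (3 ℕ.* g ℕ.+ 2)))
  + sq (+ d - + (a ℕ.* g))
  + sq (+ e - + (b ℕ.* g))
  + sq (+ (2 ^ n) - + (2 ^ (g ℕ.+ v)))
  + sq (+ (2 ^ c) - + (2 ^ (3 ℕ.* d ℕ.+ 2 ℕ.* a)))
  + sq (+ (2 ^ (c ℕ.+ 1)) - + (2 ^ (6 ℕ.* e ℕ.+ 5 ℕ.* b)))

t : ℕ → ℕ
t n = 12 ^ (3 ℕ.* n ℕ.+ 3)

-- A solution pins down c = 12^(3g+2), g + v = n, c = 3d + 2a and c + 1 = 6e + 5b (the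
-- exponential equations are injective in the exponent). Hence g, v ≤ n, all of a, b, d, e
-- are at most c + 1, and c ≤ 12^(3n+2); both n and c + 1 then lie below 12^(3n+3).
module Submission where

open import Defs
open import Data.Nat using (ℕ; _<_)
open import Data.Integer using (ℤ; +_)
open import Data.Product using (_×_)
open import Relation.Binary.PropositionalEquality using (_≡_)

open import Data.Nat as ℕ using (zero; suc; _≤_; _^_; NonZero; s≤s; z≤n)
open import Data.Nat.Properties as ℕₚ
  using (≤-trans; ≤-<-trans; <-trans; n<1+n; m≤m+n; m≤n+m; m≤n*m; +-mono-≤)
open import Data.Integer as ℤ using (-[1+_]; ∣_∣)
open import Data.Integer.Properties using (+-injective; i-j≡0⇒i≡j; ∣i∣≡0⇒i≡0)
open import Data.Product using (_,_)
open import Data.Sum using ([_,_]′)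
open import Relation.Binary using (tri<; tri≈; tri>)
open import Relation.Binary.PropositionalEquality using (refl; sym; trans; cong; subst)
open import Relation.Nullary using (contradiction)

sq≡∣i∣*∣i∣ : ∀ i → sq i ≡ + (∣ i ∣ ℕ.* ∣ i ∣)
sq≡∣i∣*∣i∣ (+ 0)     = refl
sq≡∣i∣*∣i∣ (+ suc _) = refl
sq≡∣i∣*∣i∣ -[1+ _ ] = refl

∣i∣*∣i∣≡0⇒i≡0 : ∀ i → ∣ i ∣ ℕ.* ∣ i ∣ ≡ 0 → i ≡ + 0
∣i∣*∣i∣≡0⇒i≡0 i eq = [ ∣i∣≡0⇒i≡0 , ∣i∣≡0⇒i≡0 ]′ (ℕₚ.m*n≡0⇒m≡0∨n≡0 ∣ i ∣ eq)

m+n≡0⇒m≡0×n≡0 : ∀ m n → m ℕ.+ n ≡ 0 → m ≡ 0 × n ≡ 0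
m+n≡0⇒m≡0×n≡0 m n eq = ℕₚ.m+n≡0⇒m≡0 m eq , ℕₚ.m+n≡0⇒n≡0 m eq

sum-of-six-squares≡0 : ∀ i₁ i₂ i₃ i₄ i₅ i₆ →
  sq i₁ ℤ.+ sq i₂ ℤ.+ sq i₃ ℤ.+ sq i₄ ℤ.+ sq i₅ ℤ.+ sq i₆ ≡ + 0 →
  i₁ ≡ + 0 × i₂ ≡ + 0 × i₃ ≡ + 0 × i₄ ≡ + 0 × i₅ ≡ + 0 × i₆ ≡ + 0
sum-of-six-squares≡0 i₁ i₂ i₃ i₄ i₅ i₆ eq
  rewrite sq≡∣i∣*∣i∣ i₁ | sq≡∣i∣*∣i∣ i₂ | sq≡∣i∣*∣i∣ i₃
        | sq≡∣i∣*∣i∣ i₄ | sq≡∣i∣*∣i∣ i₅ | sq≡∣i∣*∣i∣ i₆ =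
  let s₅ , e₆ = m+n≡0⇒m≡0×n≡0 _ _ (+-injective eq)
      s₄ , e₅ = m+n≡0⇒m≡0×n≡0 _ _ s₅
      s₃ , e₄ = m+n≡0⇒m≡0×n≡0 _ _ s₄
      s₂ , e₃ = m+n≡0⇒m≡0×n≡0 _ _ s₃
      e₁ , e₂ = m+n≡0⇒m≡0×n≡0 _ _ s₂
  in  ∣i∣*∣i∣≡0⇒i≡0 i₁ e₁ , ∣i∣*∣i∣≡0⇒i≡0 i₂ e₂ , ∣i∣*∣i∣≡0⇒i≡0 i₃ e₃
    , ∣i∣*∣i∣≡0⇒i≡0 i₄ e₄ , ∣i∣*∣i∣≡0⇒i≡0 i₅ e₅ , ∣i∣*∣i∣≡0⇒i≡0 i₆ e₆

+m-+n≡0⇒m≡n : ∀ m n → + m ℤ.- + n ≡ + 0 → m ≡ n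
+m-+n≡0⇒m≡n m n eq = +-injective (i-j≡0⇒i≡j (+ m) (+ n) eq)

^-injectiveʳ : ∀ m → 1 < m → ∀ {i j} → m ^ i ≡ m ^ j → i ≡ j
^-injectiveʳ m 1<m {i} {j} eq with ℕₚ.<-cmp i j
... | tri< i<j _ _ = contradiction eq (ℕₚ.<⇒≢ (ℕₚ.^-monoʳ-< m 1<m i<j))
... | tri≈ _ i≡j _ = i≡j
... | tri> _ _ j<i = contradiction eq (ℕₚ.>⇒≢ (ℕₚ.^-monoʳ-< m 1<m j<i))

+2^m-+2^n≡0⇒m≡n : ∀ m n → + (2 ^ m) ℤ.- + (2 ^ n) ≡ + 0 → m ≡ n
+2^m-+2^n≡0⇒m≡n m n eq = ^-injectiveʳ 2 (s≤s (s≤s z≤n)) (+m-+n≡0⇒m≡n _ _ eq)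

S≡0⇒exponents : ∀ n g v a b c d e → S n g v a b c d e ≡ + 0 →
  c ≡ 12 ^ (3 ℕ.* g ℕ.+ 2) × n ≡ g ℕ.+ v
  × c ≡ 3 ℕ.* d ℕ.+ 2 ℕ.* a × suc c ≡ 6 ℕ.* e ℕ.+ 5 ℕ.* b
S≡0⇒exponents n g v a b c d e eq =
  let e₁ , _ , _ , e₄ , e₅ , e₆ = sum-of-six-squares≡0
        _ (+ d ℤ.- + (a ℕ.* g)) (+ e ℤ.- + (b ℕ.* g)) _ _ _ eq
  in  +m-+n≡0⇒m≡n _ _ e₁ , +2^m-+2^n≡0⇒m≡n _ _ e₄
    , +2^m-+2^n≡0⇒m≡n _ _ e₅ , trans (ℕₚ.+-comm 1 c) (+2^m-+2^n≡0⇒m≡n _ _ e₆)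

1+m≤2*n : ∀ {m n} → 0 < n → m ≤ n → suc m ≤ 2 ℕ.* n
1+m≤2*n {m} {n} 0<n m≤n =
  subst (suc m ≤_) (cong (n ℕ.+_) (sym (ℕₚ.+-identityʳ n))) (+-mono-≤ 0<n m≤n)

n<m^n : ∀ m → 1 < m → ∀ n → n < m ^ n
n<m^n m         1<m zero    = s≤s z≤n
n<m^n m@(suc _) 1<m (suc n) =
  ≤-trans (1+m≤2*n (ℕₚ.m^n>0 m n) (n<m^n m 1<m n)) (ℕₚ.*-monoˡ-≤ (m ^ n) 1<m)

≤m^k⇒1+x<m^[1+k] : ∀ m → 2 < m → ∀ {x} k → x ≤ m ^ k → suc x < m ^ suc k
≤m^k⇒1+x<m^[1+k] m@(suc _) 2<m k x≤m^k =
  ≤-<-trans (1+m≤2*n (ℕₚ.m^n>0 m k) x≤m^k) (ℕₚ.*-monoˡ-< (m ^ k) {{ℕₚ.m^n≢0 m k}} 2<m)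

≤12^[3n+2]⇒<t : ∀ n {x} → x ≤ 12 ^ (3 ℕ.* n ℕ.+ 2) → suc x < t n
≤12^[3n+2]⇒<t n x≤ = subst (_ <_) (cong (12 ^_) (sym (ℕₚ.+-suc (3 ℕ.* n) 2)))
  (≤m^k⇒1+x<m^[1+k] 12 (s≤s (s≤s (s≤s z≤n))) (3 ℕ.* n ℕ.+ 2) x≤)

m≤n+k*m : ∀ m n k .{{_ : NonZero k}} → m ≤ n ℕ.+ k ℕ.* m
m≤n+k*m m n k = ≤-trans (m≤n*m m k) (m≤n+m _ n)

m≤k*m+n : ∀ m n k .{{_ : NonZero k}} → m ≤ k ℕ.* m ℕ.+ n
m≤k*m+n m n k = ≤-trans (m≤n*m m k) (m≤m+n _ n)

n<t : ∀ n → n < t n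
n<t n = <-trans (n<1+n n) (≤12^[3n+2]⇒<t n
  (≤-trans (m≤k*m+n n 2 3) (ℕₚ.<⇒≤ (n<m^n 12 (s≤s (s≤s z≤n)) (3 ℕ.* n ℕ.+ 2)))))

mainTheorem8 : (n g v a b c d e : ℕ) → S n g v a b c d e ≡ + 0 →
    (g < t n) × (v < t n) × (a < t n) × (b < t n) × (c < t n) × (d < t n) × (e < t n)
mainTheorem8 n g v a b c d e eq with S≡0⇒exponents n g v a b c d e eq
... | c≡12^[3g+2] , refl , c≡3d+2a , 1+c≡6e+5b =
  ≤n⇒<t (m≤m+n g v) , ≤n⇒<t (m≤n+m v g)
  , ≤c⇒<t (subst (a ≤_) (sym c≡3d+2a) (m≤n+k*m a (3 ℕ.* d) 2))
  , ≤1+c⇒<t (subst (b ≤_) (sym 1+c≡6e+5b) (m≤n+k*m b (6 ℕ.* e) 5))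
  , ≤c⇒<t ℕₚ.≤-refl
  , ≤c⇒<t (subst (d ≤_) (sym c≡3d+2a) (m≤k*m+n d (2 ℕ.* a) 3))
  , ≤1+c⇒<t (subst (e ≤_) (sym 1+c≡6e+5b) (m≤k*m+n e (5 ℕ.* b) 6))
  where
  1+c<t : suc c < t n
  1+c<t = ≤12^[3n+2]⇒<t n (subst (_≤ 12 ^ (3 ℕ.* n ℕ.+ 2)) (sym c≡12^[3g+2])
    (ℕₚ.^-monoʳ-≤ 12 (ℕₚ.+-monoˡ-≤ 2 (ℕₚ.*-monoʳ-≤ 3 (m≤m+n g v)))))

  ≤n⇒<t : ∀ {x} → x ≤ n → x < t n
  ≤n⇒<t x≤n = ≤-<-trans x≤n (n<t n)

  ≤1+c⇒<t : ∀ {x} → x ≤ suc c → x < t n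
  ≤1+c⇒<t x≤1+c = ≤-<-trans x≤1+c 1+c<t

  ≤c⇒<t : ∀ {x} → x ≤ c → x < t n
  ≤c⇒<t x≤c = ≤1+c⇒<t (ℕₚ.m≤n⇒m≤1+n x≤c)
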